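{- Let $\{f_n\}_{n\ge0}$ be the Fine numbers, i.e. $f_0=1$, $f_1=0$ and $2(n+1)f_n=(7n-5)f_{n-1}+2(2n-1)f_{n-2}$ for $n\ge2$. Then the sequence $\{f_n\}_{n\ge2}$ is log-convex.
   Context: Combinatorially, $f_n$ is the number of Dyck paths from $(0,0)$ to $(2n,0)$ (steps $(1,1)$ and $(1,-1)$, never below the $x$-axis) with no hills, a hill being a peak at height $1$; these numbers satisfy the stated recurrence. A sequence $\{z_n\}$ of positive numbers is log-convex if $z_{k-1}z_{k+1}\ge z_k^2$ for all admissible $k$. -}

module Defs where

open import Data.Nat using (ℕ; suc; _+_; _*_; _∸_; _≥_; _≤_)
open import Relation.Binary.PropositionalEquality using (_≡_)

-- f satisfies the defining data of the Fine numbers: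
-- f 0 = 1, f 1 = 0, and for n ≥ 2:
--   2(n+1) f n = (7n-5) f (n-1) + 2(2n-1) f (n-2).
-- (For n ≥ 2, 7n-5 and 2n-1 are positive, so truncated subtraction is exact.)
record IsFine (f : ℕ → ℕ) : Set where
  field
    f0  : f 0 ≡ 1
    f1  : f 1 ≡ 0
    rec : ∀ n → n ≥ 2 →
          2 * (n + 1) * f n ≡ (7 * n ∸ 5) * f (n ∸ 1) + 2 * (2 * n ∸ 1) * f (n ∸ 2)

LogConvexFrom : ℕ → (ℕ → ℕ) → Set
LogConvexFrom m z = ∀ k → suc m ≤ k → z k * z k ≤ z (k ∸ 1) * z (suc k)

-- The ratio f (n + 1) / f n is trapped between c n and c (n + 1), where
-- c n = (4n + 2) / (n + 2).  Each bound propagates to the other bound one index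
-- later through the recurrence, so both hold from n = 3 on (and the upper one
-- already at n = 2).  Hence f n / f (n - 1) ≤ c n ≤ f (n + 1) / f n, which is
-- log-convexity.
module Submission where

open import Defs
open import Data.Nat using (ℕ; zero; suc; _+_; _*_; _∸_; _≤_; z≤n; s≤s; NonZero)
open import Data.Nat.Properties
open import Data.Nat.Tactic.RingSolver using (solve)
open import Data.List using (_∷_; [])
open import Data.Product using (_×_; _,_; proj₁; proj₂)
open import Relation.Binary.PropositionalEquality using (_≡_; cong; cong₂; sym; trans; module ≡-Reasoning)

square≤*-of-separated-ratios : ∀ p q {x y z} .{{_ : NonZero p}} .{{_ : NonZero q}} →
                               p * x ≤ q * y → q * x ≤ p * z → x * x ≤ y * z
square≤*-of-separated-ratios p q {x} {y} {z} px≤qy qx≤pz =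
  *-cancelˡ-≤ (p * q) {{m*n≢0 p q}} (begin
    p * q * (x * x)   ≡⟨ solve (p ∷ q ∷ x ∷ []) ⟩
    (p * x) * (q * x) ≤⟨ *-mono-≤ px≤qy qx≤pz ⟩
    (q * y) * (p * z) ≡⟨ solve (p ∷ q ∷ y ∷ z ∷ []) ⟩
    p * q * (y * z)   ∎)
  where open ≤-Reasoning

FineStep : ℕ → ℕ → ℕ → ℕ → Set
FineStep n a b c = 2 * (n + 3) * c ≡ (7 * n + 9) * b + 2 * (2 * n + 3) * a

LowerRatio UpperRatio : (ℕ → ℕ) → ℕ → Set
LowerRatio f n = (4 * n + 2) * f n ≤ (n + 2) * f (suc n)
UpperRatio f n = (suc n + 2) * f (suc n) ≤ (4 * suc n + 2) * f n

upper⇒lower-step : ∀ n {a b c} → FineStep n a b c →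
                   (suc n + 2) * b ≤ (4 * suc n + 2) * a →
                   (4 * suc n + 2) * b ≤ (suc n + 2) * c
upper⇒lower-step n {a} {b} {c} step upper = *-cancelˡ-≤ 2 (begin
  2 * ((4 * suc n + 2) * b)              ≡⟨ solve (n ∷ b ∷ []) ⟩
  (7 * n + 9) * b + (suc n + 2) * b      ≤⟨ +-monoʳ-≤ ((7 * n + 9) * b) upper ⟩
  (7 * n + 9) * b + (4 * suc n + 2) * a  ≡⟨ cong ((7 * n + 9) * b +_) (solve (n ∷ a ∷ [])) ⟩
  (7 * n + 9) * b + 2 * (2 * n + 3) * a  ≡⟨ sym step ⟩
  2 * (n + 3) * c                        ≡⟨ solve (n ∷ c ∷ []) ⟩
  2 * ((suc n + 2) * c)                  ∎)
  where open ≤-Reasoning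

-- Multiplying the recurrence by 2n + 1 makes the lower bound applicable to the
-- term 2(2n + 3) a; what remains is the polynomial inequality
-- (n + 4)(16n² + 32n + 15) ≤ 2(n + 3)(2n + 1)(4n + 10), with slack 21n.
lower⇒upper-step : ∀ n {a b c} → FineStep n a b c →
                   (4 * n + 2) * a ≤ (n + 2) * b →
                   (2 + n + 2) * c ≤ (4 * (2 + n) + 2) * b
lower⇒upper-step n {a} {b} {c} step lower = *-cancelˡ-≤ (2 * (3 + n) * (1 + 2 * n)) (begin
  2 * (3 + n) * (1 + 2 * n) * ((2 + n + 2) * c)
    ≡⟨ solve (n ∷ c ∷ []) ⟩
  (n + 4) * (2 * n + 1) * (2 * (n + 3) * c)
    ≡⟨ cong ((n + 4) * (2 * n + 1) *_) step ⟩
  (n + 4) * (2 * n + 1) * ((7 * n + 9) * b + 2 * (2 * n + 3) * a)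
    ≡⟨ solve (n ∷ a ∷ b ∷ []) ⟩
  (n + 4) * (2 * n + 1) * (7 * n + 9) * b + (n + 4) * (2 * n + 3) * ((4 * n + 2) * a)
    ≤⟨ +-monoʳ-≤ _ (*-monoʳ-≤ ((n + 4) * (2 * n + 3)) lower) ⟩
  (n + 4) * (2 * n + 1) * (7 * n + 9) * b + (n + 4) * (2 * n + 3) * ((n + 2) * b)
    ≤⟨ m≤m+n _ (21 * n * b) ⟩
  (n + 4) * (2 * n + 1) * (7 * n + 9) * b + (n + 4) * (2 * n + 3) * ((n + 2) * b) + 21 * n * b
    ≡⟨ solve (n ∷ b ∷ []) ⟩
  2 * (3 + n) * (1 + 2 * n) * ((4 * (2 + n) + 2) * b) ∎)
  where open ≤-Reasoning

module _ {f : ℕ → ℕ} (fine : IsFine f) where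
  open IsFine fine

  fine-step : ∀ n → FineStep n (f n) (f (suc n)) (f (2 + n))
  fine-step n = begin
    2 * (n + 3) * f (2 + n)
      ≡⟨ cong (_* f (2 + n)) {2 * (n + 3)} {2 * (2 + n + 1)} (solve (n ∷ [])) ⟩
    2 * (2 + n + 1) * f (2 + n)
      ≡⟨ rec (2 + n) (s≤s (s≤s z≤n)) ⟩
    (7 * (2 + n) ∸ 5) * f (suc n) + 2 * (2 * (2 + n) ∸ 1) * f n
      ≡⟨ cong₂ (λ u v → u * f (suc n) + 2 * v * f n)
                (∸-exact 5 (7 * (2 + n)) (7 * n + 9) (solve (n ∷ [])))
                (∸-exact 1 (2 * (2 + n)) (2 * n + 3) (solve (n ∷ []))) ⟩
    (7 * n + 9) * f (suc n) + 2 * (2 * n + 3) * f n ∎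
    where
      open ≡-Reasoning
      ∸-exact : ∀ k m r → m ≡ k + r → m ∸ k ≡ r
      ∸-exact k m r m≡k+r = trans (cong (_∸ k) m≡k+r) (m+n∸m≡n k r)

  f2≡1 : f 2 ≡ 1
  f2≡1 = *-cancelˡ-≡ (f 2) 1 6 (trans (fine-step 0) (cong₂ (λ u v → 9 * u + 6 * v) f1 f0))

  f3≡2 : f 3 ≡ 2
  f3≡2 = *-cancelˡ-≡ (f 3) 2 8 (trans (fine-step 1) (cong₂ (λ u v → 16 * u + 10 * v) f2≡1 f1))

  f4≡6 : f 4 ≡ 6
  f4≡6 = *-cancelˡ-≡ (f 4) 6 10 (trans (fine-step 2) (cong₂ (λ u v → 23 * u + 14 * v) f3≡2 f2≡1))

  upper⇒lower-suc : ∀ n → UpperRatio f n → LowerRatio f (suc n)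
  upper⇒lower-suc n = upper⇒lower-step n (fine-step n)

  lower⇒upper-suc : ∀ n → LowerRatio f n → UpperRatio f (suc n)
  lower⇒upper-suc n = lower⇒upper-step n (fine-step n)

  upperRatio-2 : UpperRatio f 2
  upperRatio-2 rewrite f2≡1 | f3≡2 = m≤m+n 10 4

  ratio-bounds : ∀ m → LowerRatio f (3 + m) × UpperRatio f (3 + m)
  ratio-bounds zero rewrite f3≡2 | f4≡6 = m≤m+n 28 2 , ≤-refl
  ratio-bounds (suc m) with lower , upper ← ratio-bounds m =
    upper⇒lower-suc (3 + m) upper , lower⇒upper-suc (3 + m) lower

  upperRatio-from-2 : ∀ m → UpperRatio f (2 + m)
  upperRatio-from-2 zero    = upperRatio-2
  upperRatio-from-2 (suc m) = proj₂ (ratio-bounds m)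

corollary3p2 : (f : ℕ → ℕ) → IsFine f → LogConvexFrom 2 f
corollary3p2 f fine (suc (suc (suc m))) (s≤s (s≤s (s≤s _))) =
  square≤*-of-separated-ratios (3 + m + 2) (4 * (3 + m) + 2)
    {x = f (3 + m)} {y = f (2 + m)} {z = f (4 + m)}
    (upperRatio-from-2 fine m) (proj₁ (ratio-bounds fine m))
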